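{- A family $\mathcal T$ of theories in $\mathcal L$ satisfies $\mathcal T=\mathrm{ext}(D,\emptyset)$ for some set $D$ of normal defaults if and only if there is a set of formulas $\Psi\subseteq\mathcal L$ such that $\mathcal T=\{Cn(\Phi)\colon \Phi$ is a maximal consistent subset of $\Psi\}$.
   Context: $\mathcal L$ is the set of formulas of a propositional language over a denumerable set of atoms; $Cn$ denotes propositional consequence, and a theory is a subset of $\mathcal L$ closed under $Cn$. A default is an expression $d=\frac{\alpha:\Gamma}{\beta}$ with $\alpha,\beta\in\mathcal L$ and $\Gamma$ a finite subset of $\mathcal L$; write $p(d)=\alpha$, $j(d)=\Gamma$, $c(d)=\beta$; $d$ is normal if it has the form $\frac{\alpha:\beta}{\beta}$. A default theory is a pair $(D,W)$ with $D$ a set of defaults and $W\subseteq\mathcal L$ (its objective part). For a theory $S$, $d$ is $S$-applicable if $S\not\vdash\neg\gamma$ for every $\gamma\in j(d)$. The reduct $D_S$ is the set of monotone rules $\frac{p(d)}{c(d)}$ for $S$-applicable $d\in D$, and $Cn^{D_S}(W)$ is the set of formulas provable from $W$ in propositional calculus extended by the rules in $D_S$. A theory $S$ is an extension of $(D,W)$ iff $S=Cn^{D_S}(W)$; $\mathrm{ext}(D,W)$ denotes the family of all extensions. -}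

module Defs where

open import Data.Nat using (ℕ)
open import Data.Bool using (Bool; true; false; not; _∨_)
open import Data.List using (List)
open import Data.List.Membership.Propositional using (_∈_)
open import Data.Product using (_×_; Σ; ∃; ∃-syntax; _,_)
open import Relation.Binary.PropositionalEquality using (_≡_)
open import Relation.Nullary using (¬_)
open import Relation.Unary using (Pred; _⊆_; ∅)

data Formula : Set where
  atom : ℕ → Formula
  ⊥′   : Formula
  _⇒_  : Formula → Formula → Formula

infixr 5 _⇒_

neg : Formula → Formula
neg φ = φ ⇒ ⊥′

-- Truth-value semantics (used only to define the axioms: all tautologies).
eval : (ℕ → Bool) → Formula → Bool
eval v (atom n) = v n
eval v ⊥′ = false
eval v (φ ⇒ ψ) = not (eval v φ) ∨ eval v ψ

Tautology : Formula → Set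
Tautology φ = ∀ (v : ℕ → Bool) → eval v φ ≡ true

FSet : Set₁
FSet = Pred Formula _

RuleSet : Set₁
RuleSet = Pred (Formula × Formula) _

-- Cn^R(W): provability from W in propositional calculus
-- (axioms: all tautologies; rule: modus ponens) extended by the rules in R.
data Deriv (R : RuleSet) (W : FSet) : Formula → Set where
  hyp  : ∀ {φ} → W φ → Deriv R W φ
  taut : ∀ {φ} → Tautology φ → Deriv R W φ
  mp   : ∀ {φ ψ} → Deriv R W φ → Deriv R W (φ ⇒ ψ) → Deriv R W ψ
  rule : ∀ {α β} → R (α , β) → Deriv R W α → Deriv R W β

Cn : FSet → FSet
Cn W = Deriv ∅ W

IsTheory : FSet → Set
IsTheory S = Cn S ⊆ S

_≐_ : FSet → FSet → Set
A ≐ B = (A ⊆ B) × (B ⊆ A)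

-- Defaults α : Γ / β with Γ finite.
record Default : Set where
  constructor mkDefault
  field
    p : Formula
    j : List Formula
    c : Formula
open Default public

Normal : Default → Set
Normal d = Σ Formula λ β → (j d ≡ (β Data.List.∷ Data.List.[])) × (c d ≡ β)

DSet : Set₁
DSet = Pred Default _

Applicable : FSet → Default → Set
Applicable S d = ∀ {γ} → γ ∈ j d → ¬ Cn S (neg γ)

Reduct : DSet → FSet → RuleSet
Reduct D S (α , β) = Σ Default λ d → D d × Applicable S d × (p d ≡ α) × (c d ≡ β)

IsExtension : DSet → FSet → FSet → Set
IsExtension D W S = S ≐ Deriv (Reduct D S) W

open import Level using (Lift)

-- membership of a family is allowed to be a large proposition
Family : Set₂
Family = FSet → Set₁

ext : DSet → FSet → Family
ext D W S = Lift _ (IsExtension D W S)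

_≋_ : Family → Family → Set₁
T ≋ U = (∀ S → T S → ∃[ S′ ] (U S′ × (S ≐ S′)))
      × (∀ S → U S → ∃[ S′ ] (T S′ × (S ≐ S′)))

Consistent : FSet → Set
Consistent Φ = ¬ Cn Φ ⊥′

MaxConsistentSubset : FSet → FSet → Set₁
MaxConsistentSubset Ψ Φ =
  (Φ ⊆ Ψ) × Consistent Φ × (∀ (Φ′ : FSet) → Φ ⊆ Φ′ → Φ′ ⊆ Ψ → Consistent Φ′ → Φ′ ⊆ Φ)

MCFamily : FSet → Family
MCFamily Ψ S = ∃[ Φ ] (MaxConsistentSubset Ψ Φ × (S ≐ Cn Φ))

-- For normal defaults over an empty objective part a default is applicable exactly when its
-- conclusion is consistent with the candidate extension, and every formula of an extension is
-- entailed by the conjunction of the conclusions of a grounded sequence of applied defaults.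
-- Taking Ψ to be all such conjunctions, E ↦ Ψ ∩ E and Φ ↦ Cn Φ are mutually inverse between
-- extensions and maximal consistent subsets of Ψ. Conversely, any Ψ is realised by the
-- prerequisite-free normal defaults ⊤ : ψ / ψ (ψ ∈ Ψ): an extension E is then the closure of
-- the ψ ∈ Ψ consistent with E, which is precisely a maximal consistent subset of Ψ.
module Submission where

open import Defs
open import Data.Bool using (Bool; true; false; not; _∨_)
open import Data.List using (List; []; _∷_; _++_)
open import Data.List.Relation.Unary.All as All using (All; []; _∷_)
open import Data.List.Relation.Unary.All.Properties using (++⁺)
open import Data.List.Relation.Unary.Any using (here)
open import Data.List.Membership.Propositional using (_∈_)
open import Data.Nat using (ℕ)
open import Data.Product using (_×_; Σ; ∃-syntax; _,_; proj₁; proj₂)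
open import Data.Sum using (inj₁; inj₂)
open import Data.Unit using (⊤; tt)
open import Function using (_∘_; id)
open import Level using (lift)
open import Relation.Binary.PropositionalEquality using (_≡_; refl; sym; subst)
open import Relation.Nullary using (¬_)
open import Relation.Unary using (∅; _⊆_; _∪_; ｛_｝)
open import Relation.Unary.Properties using (≐-refl; ≐-sym; ≐-trans)

Holds : (ℕ → Bool) → Formula → Set
Holds v φ = eval v φ ≡ true

infix 4 _⊨_

_⊨_ : Formula → Formula → Set
φ ⊨ ψ = ∀ v → Holds v φ → Holds v ψ

⊤′ : Formula
⊤′ = ⊥′ ⇒ ⊥′

infixr 6 _∧′_

_∧′_ : Formula → Formula → Formula
φ ∧′ ψ = neg (φ ⇒ neg ψ)

⇒-intro : ∀ {v} φ ψ → (Holds v φ → Holds v ψ) → Holds v (φ ⇒ ψ)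
⇒-intro {v} φ ψ = table (eval v φ) (eval v ψ)
  where
  table : ∀ x y → (x ≡ true → y ≡ true) → not x ∨ y ≡ true
  table true  _ h = h refl
  table false _ _ = refl

⇒-elim : ∀ {v} φ ψ → Holds v (φ ⇒ ψ) → Holds v φ → Holds v ψ
⇒-elim {v} φ ψ h hφ = subst (λ b → not b ∨ eval v ψ ≡ true) hφ h

∧-intro : ∀ {v} φ ψ → Holds v φ → Holds v ψ → Holds v (φ ∧′ ψ)
∧-intro φ ψ hφ hψ = ⇒-intro (φ ⇒ neg ψ) ⊥′ λ h → ⇒-elim ψ ⊥′ (⇒-elim φ (neg ψ) h hφ) hψ

∧-elim : ∀ {v} φ ψ → Holds v (φ ∧′ ψ) → Holds v φ × Holds v ψ
∧-elim {v} φ ψ = table (eval v φ) (eval v ψ)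
  where
  table : ∀ x y → not (not x ∨ (not y ∨ false)) ∨ false ≡ true → x ≡ true × y ≡ true
  table true  true  _ = refl , refl
  table true  false ()
  table false _     ()

⊨-Deriv : ∀ {R W φ ψ} → φ ⊨ ψ → Deriv R W φ → Deriv R W ψ
⊨-Deriv {φ = φ} {ψ} φ⊨ψ d = mp d (taut λ v → ⇒-intro φ ψ (φ⊨ψ v))

Deriv-∧ : ∀ {R W φ ψ} → Deriv R W φ → Deriv R W ψ → Deriv R W (φ ∧′ ψ)
Deriv-∧ {φ = φ} {ψ} dφ dψ =
  mp dψ (mp dφ (taut λ v → ⇒-intro φ (ψ ⇒ φ ∧′ ψ) λ hφ → ⇒-intro ψ (φ ∧′ ψ) (∧-intro φ ψ hφ)))

Deriv-explode : ∀ {R W} ψ → Deriv R W ⊥′ → Deriv R W ψ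
Deriv-explode ψ = ⊨-Deriv λ _ ()

Deriv-cut : ∀ {R W W′} → W′ ⊆ Deriv R W → Deriv R W′ ⊆ Deriv R W
Deriv-cut f (hyp x)    = f x
Deriv-cut f (taut t)   = taut t
Deriv-cut f (mp d e)   = mp (Deriv-cut f d) (Deriv-cut f e)
Deriv-cut f (rule r d) = rule r (Deriv-cut f d)

Deriv-mono-hyps : ∀ {R W W′} → W ⊆ W′ → Deriv R W ⊆ Deriv R W′
Deriv-mono-hyps W⊆W′ = Deriv-cut (hyp ∘ W⊆W′)

Cn⊆Deriv : ∀ {R W} → Cn W ⊆ Deriv R W
Cn⊆Deriv (hyp x)   = hyp x
Cn⊆Deriv (taut t)  = taut t
Cn⊆Deriv (mp d e)  = mp (Cn⊆Deriv d) (Cn⊆Deriv e)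
Cn⊆Deriv (rule () _)

Cn-idem : ∀ {Φ} → Cn (Cn Φ) ⊆ Cn Φ
Cn-idem = Deriv-cut id

Deriv-ruleless : ∀ {R W} → (∀ {r} → ¬ R r) → Deriv R W ⊆ Cn W
Deriv-ruleless noRule (hyp x)    = hyp x
Deriv-ruleless noRule (taut t)   = taut t
Deriv-ruleless noRule (mp d e)   = mp (Deriv-ruleless noRule d) (Deriv-ruleless noRule e)
Deriv-ruleless noRule (rule r _) with noRule r
... | ()

Cn-sound : ∀ {W φ} v → (∀ {ψ} → W ψ → Holds v ψ) → Cn W φ → Holds v φ
Cn-sound v hW (hyp x)            = hW x
Cn-sound v hW (taut t)           = t v
Cn-sound v hW (mp {φ} {ψ} d e)   = ⇒-elim φ ψ (Cn-sound v hW e) (Cn-sound v hW d)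
Cn-sound v hW (rule () _)

Consistent-∅ : Consistent ∅
Consistent-∅ d with Cn-sound (λ _ → true) (λ ()) d
... | ()

deduction : ∀ {Φ φ χ} → Cn (Φ ∪ ｛ φ ｝) χ → Cn Φ (φ ⇒ χ)
deduction {φ = φ} {χ} (hyp (inj₁ x)) = ⊨-Deriv (λ v hχ → ⇒-intro φ χ λ _ → hχ) (hyp x)
deduction {φ = φ} (hyp (inj₂ refl))  = taut λ v → ⇒-intro φ φ id
deduction {φ = φ} {χ} (taut t)       = taut λ v → ⇒-intro φ χ λ _ → t v
deduction {φ = φ} (mp {ψ} {χ} d e)   =
  mp (deduction e) (mp (deduction d) (taut λ v →
    ⇒-intro (φ ⇒ ψ) ((φ ⇒ ψ ⇒ χ) ⇒ φ ⇒ χ) λ φψ → ⇒-intro (φ ⇒ ψ ⇒ χ) (φ ⇒ χ) λ φψχ →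
      ⇒-intro φ χ λ hφ → ⇒-elim ψ χ (⇒-elim φ (ψ ⇒ χ) φψχ hφ) (⇒-elim φ ψ φψ hφ)))
deduction (rule () _)

MaxConsistentSubset-insert : ∀ {Ψ Φ ψ} → MaxConsistentSubset Ψ Φ → Ψ ψ → ¬ Cn Φ (neg ψ) → Φ ψ
MaxConsistentSubset-insert {Ψ} {Φ} {ψ} (Φ⊆Ψ , _ , maximal) Ψψ ⊬¬ψ =
  maximal (Φ ∪ ｛ ψ ｝) inj₁ Φψ⊆Ψ (⊬¬ψ ∘ deduction) (inj₂ refl)
  where
  Φψ⊆Ψ : Φ ∪ ｛ ψ ｝ ⊆ Ψ
  Φψ⊆Ψ (inj₁ x)    = Φ⊆Ψ x
  Φψ⊆Ψ (inj₂ refl) = Ψψ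

MaxConsistentSubset-closed : ∀ {Ψ Φ ψ} → MaxConsistentSubset Ψ Φ → Ψ ψ → Cn Φ ψ → Φ ψ
MaxConsistentSubset-closed mc@(_ , consistent , _) Ψψ ⊢ψ =
  MaxConsistentSubset-insert mc Ψψ (consistent ∘ mp ⊢ψ)

Directed : FSet → Set
Directed Φ = (∃[ φ ] Φ φ) × (∀ {φ ψ} → Φ φ → Φ ψ → ∃[ χ ] (Φ χ × χ ⊨ φ × χ ⊨ ψ))

Cn-directed : ∀ {Φ α} → Directed Φ → Cn Φ α → ∃[ φ ] (Φ φ × φ ⊨ α)
Cn-directed _                (hyp x)  = _ , x , λ _ → id
Cn-directed ((φ , x) , _)    (taut t) = φ , x , λ v _ → t v
Cn-directed dir@(_ , bound)  (mp {α} {β} d e) with Cn-directed dir d | Cn-directed dir e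
... | _ , x , ⊨α | _ , y , ⊨α⇒β with bound x y
...   | χ , z , χ⊨ , χ⊨′ = χ , z , λ v h → ⇒-elim α β (⊨α⇒β v (χ⊨′ v h)) (⊨α v (χ⊨ v h))
Cn-directed _                (rule () _)

applicable⁺ : ∀ {S : FSet} d → Normal d → ¬ Cn S (neg (c d)) → Applicable S d
applicable⁺ {S} _ (_ , refl , c≡β) ⊬¬c (here refl) = subst (λ γ → ¬ Cn S (neg γ)) c≡β ⊬¬c

applicable⁻ : ∀ {S : FSet} d → Normal d → Applicable S d → ¬ Cn S (neg (c d))
applicable⁻ d (_ , j≡ , c≡β) app = app (subst (c d ∈_) (sym j≡) (here c≡β))

extension-isTheory : ∀ {D W E} → IsExtension D W E → IsTheory E
extension-isTheory (E⊆ , ⊆E) = ⊆E ∘ Deriv-cut E⊆ ∘ Cn⊆Deriv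

-- An inconsistent E would refute every normal conclusion, leaving the reduct without rules.
extension-consistent : ∀ {D : DSet} {W E} → (∀ d → D d → Normal d) → Consistent W →
                       IsExtension D W E → ¬ E ⊥′
extension-consistent {E = E} normal consistent (E⊆ , _) E⊥ =
  consistent (Deriv-ruleless noRule (E⊆ E⊥))
  where
  noRule : ∀ {r} → ¬ Reduct _ E r
  noRule (d , Dd , app , _) = applicable⁻ d (normal d Dd) app (Deriv-explode _ (hyp E⊥))

≋-sym : ∀ {𝒯 𝒰} → 𝒯 ≋ 𝒰 → 𝒰 ≋ 𝒯
≋-sym (𝒯→𝒰 , 𝒰→𝒯) = 𝒰→𝒯 , 𝒯→𝒰

≋-trans : ∀ {𝒯 𝒰 𝒱} → 𝒯 ≋ 𝒰 → 𝒰 ≋ 𝒱 → 𝒯 ≋ 𝒱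
≋-trans (𝒯→𝒰 , 𝒰→𝒯) (𝒰→𝒱 , 𝒱→𝒰) = compose 𝒯→𝒰 𝒰→𝒱 , compose 𝒱→𝒰 𝒰→𝒯
  where
  compose : ∀ {𝒜 ℬ 𝒞 : Family} →
            (∀ S → 𝒜 S → ∃[ S′ ] (ℬ S′ × (S ≐ S′))) → (∀ S → ℬ S → ∃[ S′ ] (𝒞 S′ × (S ≐ S′))) →
            ∀ S → 𝒜 S → ∃[ S′ ] (𝒞 S′ × (S ≐ S′))
  compose f g S x with f S x
  ... | S′ , y , S≐S′ with g S′ y
  ...   | S″ , z , S′≐S″ = S″ , z , ≐-trans S≐S′ S′≐S″

ext≋MCFamily : ∀ {D Ψ} →
               (∀ {E} → IsExtension D ∅ E → MCFamily Ψ E) →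
               (∀ {Φ} → MaxConsistentSubset Ψ Φ → IsExtension D ∅ (Cn Φ)) →
               ext D ∅ ≋ MCFamily Ψ
ext≋MCFamily ext⇒mc mc⇒ext =
  (λ E (lift isExt) → E , ext⇒mc isExt , ≐-refl) ,
  (λ S (Φ , mc , S≐CnΦ) → Cn Φ , lift (mc⇒ext mc) , S≐CnΦ)

conclusions : List Default → Formula
conclusions []       = ⊤′
conclusions (d ∷ ds) = c d ∧′ conclusions ds

-- The list records default applications latest first: each prerequisite must follow from the
-- conclusions of the defaults applied before it.
Grounded : List Default → Set
Grounded []       = ⊤
Grounded (d ∷ ds) = Grounded ds × conclusions ds ⊨ p d

groundedConclusions : DSet → FSet
groundedConclusions D φ = ∃[ ds ] (All D ds × Grounded ds × φ ≡ conclusions ds)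

conclusions-++⁻ : ∀ {v} xs ys → Holds v (conclusions (xs ++ ys)) →
                  Holds v (conclusions xs) × Holds v (conclusions ys)
conclusions-++⁻ []       ys h = refl , h
conclusions-++⁻ (x ∷ xs) ys h with ∧-elim (c x) (conclusions (xs ++ ys)) h
... | hx , hxs++ys with conclusions-++⁻ xs ys hxs++ys
...   | hxs , hys = ∧-intro (c x) (conclusions xs) hx hxs , hys

conclusions-++⁺ : ∀ {v} xs ys → Holds v (conclusions xs) → Holds v (conclusions ys) →
                  Holds v (conclusions (xs ++ ys))
conclusions-++⁺ []       ys _   hys = hys
conclusions-++⁺ (x ∷ xs) ys hxs hys with ∧-elim (c x) (conclusions xs) hxs
... | hx , hxs′ = ∧-intro (c x) (conclusions (xs ++ ys)) hx (conclusions-++⁺ xs ys hxs′ hys)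

Grounded-++ : ∀ xs ys → Grounded xs → Grounded ys → Grounded (xs ++ ys)
Grounded-++ []       ys _ gys = gys
Grounded-++ (x ∷ xs) ys (gxs , ⊨px) gys =
  Grounded-++ xs ys gxs gys , λ v h → ⊨px v (proj₁ (conclusions-++⁻ xs ys h))

Deriv-reduct⇒grounded : ∀ {D S φ} → Deriv (Reduct D S) ∅ φ →
  ∃[ ds ] (All (λ d → D d × Applicable S d) ds × Grounded ds × conclusions ds ⊨ φ)
Deriv-reduct⇒grounded (taut t) = [] , [] , tt , λ v _ → t v
Deriv-reduct⇒grounded (mp {φ} {ψ} d e)
  with Deriv-reduct⇒grounded d | Deriv-reduct⇒grounded e
... | xs , axs , gxs , ⊨φ | ys , ays , gys , ⊨φ⇒ψ =
  xs ++ ys , ++⁺ axs ays , Grounded-++ xs ys gxs gys ,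
  λ v h → let hxs , hys = conclusions-++⁻ xs ys h in ⇒-elim φ ψ (⊨φ⇒ψ v hys) (⊨φ v hxs)
Deriv-reduct⇒grounded (rule (d , Dd , app , refl , refl) prereq) with Deriv-reduct⇒grounded prereq
... | ds , ads , gds , ⊨pd =
  d ∷ ds , (Dd , app) ∷ ads , (gds , ⊨pd) , λ v → proj₁ ∘ ∧-elim (c d) (conclusions ds)

grounded⇒Deriv-reduct : ∀ {D S W ds} → All (λ d → D d × Applicable S d) ds → Grounded ds →
                        Deriv (Reduct D S) W (conclusions ds)
grounded⇒Deriv-reduct [] _ = taut λ _ → refl
grounded⇒Deriv-reduct {ds = d ∷ ds} ((Dd , app) ∷ ads) (gds , ⊨pd) =
  Deriv-∧ (rule (d , Dd , app , refl , refl) (⊨-Deriv ⊨pd ⊢ds)) ⊢ds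
  where
  ⊢ds = grounded⇒Deriv-reduct ads gds

conclusions-applicable : ∀ {D : DSet} {S Γ : FSet} {ds} → (∀ d → D d → Normal d) →
                         Consistent Γ → S ⊆ Cn Γ → Cn Γ (conclusions ds) →
                         All D ds → All (λ d → D d × Applicable S d) ds
conclusions-applicable _ _ _ _ [] = []
conclusions-applicable {ds = d ∷ ds} normal consistent S⊆CnΓ ⊢conclusions (Dd ∷ Dds) =
  (Dd , applicable⁺ d (normal d Dd) λ ⊢¬c → consistent (mp ⊢c (Deriv-cut S⊆CnΓ ⊢¬c))) ∷
  conclusions-applicable normal consistent S⊆CnΓ ⊢conclusions′ Dds
  where
  ⊢c = ⊨-Deriv (λ v → proj₁ ∘ ∧-elim (c d) (conclusions ds)) ⊢conclusions
  ⊢conclusions′ = ⊨-Deriv (λ v → proj₂ ∘ ∧-elim (c d) (conclusions ds)) ⊢conclusions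

maxConsistent-grounded-directed : ∀ {D Φ} → MaxConsistentSubset (groundedConclusions D) Φ → Directed Φ
maxConsistent-grounded-directed {Φ = Φ} mc@(Φ⊆Ψ , _ , _) =
  (⊤′ , MaxConsistentSubset-closed mc ([] , [] , tt , refl) (taut λ _ → refl)) , bound
  where
  bound : ∀ {φ ψ} → Φ φ → Φ ψ → ∃[ χ ] (Φ χ × χ ⊨ φ × χ ⊨ ψ)
  bound x y with Φ⊆Ψ x | Φ⊆Ψ y
  ... | xs , Dxs , gxs , refl | ys , Dys , gys , refl =
    conclusions (xs ++ ys) ,
    MaxConsistentSubset-closed mc (xs ++ ys , ++⁺ Dxs Dys , Grounded-++ xs ys gxs gys , refl)
      (⊨-Deriv (λ v h → let hxs , hys = ∧-elim (conclusions xs) (conclusions ys) h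
                        in conclusions-++⁺ xs ys hxs hys)
               (Deriv-∧ (hyp x) (hyp y))) ,
    (λ v → proj₁ ∘ conclusions-++⁻ xs ys) , (λ v → proj₂ ∘ conclusions-++⁻ xs ys)

module _ {D : DSet} (normal : ∀ d → D d → Normal d) where

  extension⇒grounded-MC : ∀ {E} → IsExtension D ∅ E → MCFamily (groundedConclusions D) E
  extension⇒grounded-MC {E} isExt@(E⊆ , ⊆E) = Φ , (proj₁ , consistent , maximal) , E⊆CnΦ , CnΦ⊆E
    where
    Φ : FSet
    Φ φ = groundedConclusions D φ × E φ

    CnΦ⊆E : Cn Φ ⊆ E
    CnΦ⊆E = extension-isTheory isExt ∘ Deriv-mono-hyps proj₂

    E⊆CnΦ : E ⊆ Cn Φ
    E⊆CnΦ x with Deriv-reduct⇒grounded (E⊆ x)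
    ... | ds , ads , gds , ⊨φ =
      ⊨-Deriv ⊨φ (hyp ((ds , All.map proj₁ ads , gds , refl) , ⊆E (grounded⇒Deriv-reduct ads gds)))

    consistent : Consistent Φ
    consistent = extension-consistent normal Consistent-∅ isExt ∘ CnΦ⊆E

    maximal : ∀ Φ′ → Φ ⊆ Φ′ → Φ′ ⊆ groundedConclusions D → Consistent Φ′ → Φ′ ⊆ Φ
    maximal Φ′ Φ⊆Φ′ Φ′⊆Ψ consistent′ x with Φ′⊆Ψ x
    ... | ds , Dds , gds , refl =
      (ds , Dds , gds , refl) ,
      ⊆E (grounded⇒Deriv-reduct
            (conclusions-applicable normal consistent′ (Deriv-mono-hyps Φ⊆Φ′ ∘ E⊆CnΦ) (hyp x) Dds) gds)

  grounded-MC⇒extension : ∀ {Φ} → MaxConsistentSubset (groundedConclusions D) Φ → IsExtension D ∅ (Cn Φ)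
  grounded-MC⇒extension {Φ} mc@(Φ⊆Ψ , consistent , _) = CnΦ⊆ , ⊆CnΦ
    where
    directed = maxConsistent-grounded-directed mc

    CnΦ⊆ : Cn Φ ⊆ Deriv (Reduct D (Cn Φ)) ∅
    CnΦ⊆ ⊢α with Cn-directed directed ⊢α
    ... | _ , x , ⊨α with Φ⊆Ψ x
    ...   | ds , Dds , gds , refl =
      ⊨-Deriv ⊨α (grounded⇒Deriv-reduct (conclusions-applicable normal consistent id (hyp x) Dds) gds)

    -- The prerequisite is entailed by some grounded conjunction in Φ; adding d on top keeps it
    -- grounded, and applicability makes the extended conjunction consistent with Φ.
    conclusion∈CnΦ : ∀ {d} → D d → Applicable (Cn Φ) d → Cn Φ (p d) → Cn Φ (c d)
    conclusion∈CnΦ {d} Dd app ⊢pd with Cn-directed directed ⊢pd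
    ... | _ , x , ⊨pd with Φ⊆Ψ x
    ...   | ds , Dds , gds , refl =
      ⊨-Deriv (λ v → proj₁ ∘ ∧-elim (c d) (conclusions ds)) (hyp extended)
      where
      refutes-c : ∀ v → Holds v (conclusions ds ∧′ neg (conclusions (d ∷ ds))) → Holds v (neg (c d))
      refutes-c v h = let hds , h¬ = ∧-elim (conclusions ds) (neg (conclusions (d ∷ ds))) h in
        ⇒-intro (c d) ⊥′ λ hc → ⇒-elim (conclusions (d ∷ ds)) ⊥′ h¬ (∧-intro (c d) (conclusions ds) hc hds)

      extended : Φ (conclusions (d ∷ ds))
      extended = MaxConsistentSubset-insert mc (d ∷ ds , Dd ∷ Dds , (gds , ⊨pd) , refl)
        λ ⊢¬ → applicable⁻ d (normal d Dd) app (hyp (⊨-Deriv refutes-c (Deriv-∧ (hyp x) ⊢¬)))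

    ⊆CnΦ : Deriv (Reduct D (Cn Φ)) ∅ ⊆ Cn Φ
    ⊆CnΦ (taut t) = taut t
    ⊆CnΦ (mp d e) = mp (⊆CnΦ d) (⊆CnΦ e)
    ⊆CnΦ (rule (_ , Dd , app , refl , refl) prereq) = conclusion∈CnΦ Dd app (⊆CnΦ prereq)

  ext≋MCFamily-groundedConclusions : ext D ∅ ≋ MCFamily (groundedConclusions D)
  ext≋MCFamily-groundedConclusions = ext≋MCFamily extension⇒grounded-MC grounded-MC⇒extension

assumption : Formula → Default
assumption ψ = mkDefault ⊤′ (ψ ∷ []) ψ

assumptions : FSet → DSet
assumptions Ψ d = ∃[ ψ ] (Ψ ψ × d ≡ assumption ψ)

assumptions-normal : ∀ Ψ d → assumptions Ψ d → Normal d
assumptions-normal Ψ _ (ψ , _ , refl) = ψ , refl , refl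

Admissible : FSet → FSet → FSet
Admissible Ψ S ψ = Ψ ψ × ¬ Cn S (neg ψ)

Admissible⊆Deriv-reduct : ∀ {Ψ S W} → Admissible Ψ S ⊆ Deriv (Reduct (assumptions Ψ) S) W
Admissible⊆Deriv-reduct (Ψψ , ⊬¬ψ) =
  rule (assumption _ , (_ , Ψψ , refl) , applicable⁺ (assumption _) (_ , refl , refl) ⊬¬ψ , refl , refl)
       (taut λ _ → refl)

Deriv-reduct⊆Cn-Admissible : ∀ {Ψ S} → Deriv (Reduct (assumptions Ψ) S) ∅ ⊆ Cn (Admissible Ψ S)
Deriv-reduct⊆Cn-Admissible (taut t) = taut t
Deriv-reduct⊆Cn-Admissible (mp d e) = mp (Deriv-reduct⊆Cn-Admissible d) (Deriv-reduct⊆Cn-Admissible e)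
Deriv-reduct⊆Cn-Admissible (rule (_ , (_ , Ψψ , refl) , app , refl , refl) _) = hyp (Ψψ , app (here refl))

module _ {Ψ : FSet} where

  extension⇒assumption-MC : ∀ {E} → IsExtension (assumptions Ψ) ∅ E → MCFamily Ψ E
  extension⇒assumption-MC {E} isExt@(E⊆ , ⊆E) =
    Admissible Ψ E , (proj₁ , consistent , maximal) , E⊆CnΦ , CnΦ⊆E
    where
    E⊆CnΦ : E ⊆ Cn (Admissible Ψ E)
    E⊆CnΦ = Deriv-reduct⊆Cn-Admissible ∘ E⊆

    CnΦ⊆E : Cn (Admissible Ψ E) ⊆ E
    CnΦ⊆E = ⊆E ∘ Deriv-cut Admissible⊆Deriv-reduct ∘ Cn⊆Deriv

    consistent : Consistent (Admissible Ψ E)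
    consistent = extension-consistent (assumptions-normal Ψ) Consistent-∅ isExt ∘ CnΦ⊆E

    maximal : ∀ Φ′ → Admissible Ψ E ⊆ Φ′ → Φ′ ⊆ Ψ → Consistent Φ′ → Φ′ ⊆ Admissible Ψ E
    maximal Φ′ Φ⊆Φ′ Φ′⊆Ψ consistent′ x =
      Φ′⊆Ψ x , λ ⊢¬ψ → consistent′ (mp (hyp x) (Deriv-mono-hyps Φ⊆Φ′ (Deriv-cut E⊆CnΦ ⊢¬ψ)))

  assumption-MC⇒extension : ∀ {Φ} → MaxConsistentSubset Ψ Φ → IsExtension (assumptions Ψ) ∅ (Cn Φ)
  assumption-MC⇒extension {Φ} mc@(Φ⊆Ψ , consistent , _) = CnΦ⊆ , ⊆CnΦ
    where
    Φ⊆Admissible : Φ ⊆ Admissible Ψ (Cn Φ)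
    Φ⊆Admissible x = Φ⊆Ψ x , λ ⊢¬ψ → consistent (mp (hyp x) (Cn-idem ⊢¬ψ))

    Admissible⊆Φ : Admissible Ψ (Cn Φ) ⊆ Φ
    Admissible⊆Φ (Ψψ , ⊬¬ψ) = MaxConsistentSubset-insert mc Ψψ (⊬¬ψ ∘ hyp)

    CnΦ⊆ : Cn Φ ⊆ Deriv (Reduct (assumptions Ψ) (Cn Φ)) ∅
    CnΦ⊆ = Deriv-cut (Admissible⊆Deriv-reduct ∘ Φ⊆Admissible) ∘ Cn⊆Deriv

    ⊆CnΦ : Deriv (Reduct (assumptions Ψ) (Cn Φ)) ∅ ⊆ Cn Φ
    ⊆CnΦ = Deriv-mono-hyps Admissible⊆Φ ∘ Deriv-reduct⊆Cn-Admissible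

  ext-assumptions≋MCFamily : ext (assumptions Ψ) ∅ ≋ MCFamily Ψ
  ext-assumptions≋MCFamily = ext≋MCFamily extension⇒assumption-MC assumption-MC⇒extension

mainTheorem10 : (𝒯 : Family) → (∀ S → 𝒯 S → IsTheory S) →
    ((Σ DSet λ D → (∀ d → D d → Normal d) × (𝒯 ≋ ext D ∅)) → ∃[ Ψ ] (𝒯 ≋ MCFamily Ψ))
    × (∃[ Ψ ] (𝒯 ≋ MCFamily Ψ) → Σ DSet λ D → (∀ d → D d → Normal d) × (𝒯 ≋ ext D ∅))
mainTheorem10 𝒯 _ =
  (λ (D , normal , 𝒯≋ext) →
     groundedConclusions D , ≋-trans 𝒯≋ext (ext≋MCFamily-groundedConclusions normal)) ,
  (λ (Ψ , 𝒯≋MC) →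
     assumptions Ψ , assumptions-normal Ψ , ≋-trans 𝒯≋MC (≋-sym ext-assumptions≋MCFamily))
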